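{- Let $m,n\ge 3$ and $T_{m,n}=C_m\Box C_n$. Then $\chi(T_{m,n}^2)\ge 5$. Moreover, $\chi(T_{m,n}^2)=5$ if and only if $m\equiv 0\pmod 5$ and $n\equiv 0\pmod 5$.
   Context: $C_j$ denotes the cycle on $j$ vertices; $\Box$ is the Cartesian product of graphs. The square $G^2$ of a graph $G$ has vertex set $V(G)$, two distinct vertices being adjacent iff their distance in $G$ is at most 2. $\chi$ is the chromatic number. -}

module Defs where

open import Level using (Level; suc; _⊔_)
open import Data.Nat using (ℕ; zero; _<_) renaming (suc to sucℕ)
open import Data.Fin using (Fin; toℕ)
open import Data.Product using (Σ; _×_; ∃-syntax)
open import Data.Sum using (_⊎_)
open import Relation.Binary.PropositionalEquality using (_≡_; _≢_)
open import Relation.Nullary using (¬_)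

record Graph : Set₁ where
  field
    V   : Set
    Adj : V → V → Set
open Graph public

CycAdj : (m : ℕ) → Fin m → Fin m → Set
CycAdj m i j =
  (sucℕ (toℕ i) ≡ toℕ j) ⊎ (sucℕ (toℕ j) ≡ toℕ i)
  ⊎ ((sucℕ (toℕ i) ≡ m) × (toℕ j ≡ zero))
  ⊎ ((sucℕ (toℕ j) ≡ m) × (toℕ i ≡ zero))

-- The cycle C_m (a genuine cycle for m ≥ 3).
Cycle : ℕ → Graph
Cycle m = record { V = Fin m ; Adj = CycAdj m }

_□_ : Graph → Graph → Graph
G □ H = record
  { V = V G × V H
  ; Adj = λ { (g , h) (g' , h') →
        (Adj G g g' × h ≡ h') ⊎ (g ≡ g' × Adj H h h') } }
  where open import Data.Product using (_,_)

Square : Graph → Graph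
Square G = record
  { V = V G
  ; Adj = λ u v → u ≢ v × (Adj G u v ⊎ ∃[ w ] (Adj G u w × Adj G w v)) }

Torus : ℕ → ℕ → Graph
Torus m n = Cycle m □ Cycle n

Colorable : Graph → ℕ → Set
Colorable G k = Σ (V G → Fin k) λ c → ∀ u v → Adj G u v → c u ≢ c v

ChromaticNumber≡ : Graph → ℕ → Set
ChromaticNumber≡ G k = Colorable G k × (∀ j → j < k → ¬ Colorable G j)

ChromaticNumber≥ : Graph → ℕ → Set
ChromaticNumber≥ G k = ∀ j → j < k → ¬ Colorable G j

-- A vertex of the torus and its four neighbours are pairwise at distance
-- ≤ 2, so they form a 5-clique of the square; `occurs`/`unique⇒≤` are the
-- pigeonhole facts used to exploit such cliques.  To analyse colourings we
-- unfold the torus onto the grid ℕ × ℕ via a ↦ a mod m: a proper colouring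
-- of the square of C_m □ C_n becomes a `GridColouring` (cells at distance
-- 1 or 2 get distinct colours) with periods m and n (`Unfolding`).  With exactly five
-- colours every closed neighbourhood shows each colour once; chasing a
-- colour through neighbouring balls shows that cells 3 and 4 apart in a row
-- differ, so each row is 5-periodic and every horizontal period is a
-- multiple of 5 (`FiveColouring`); transposing handles the columns.
-- Conversely, if 5 ∣ m and 5 ∣ n then reduction mod 5 maps C_m □ C_n onto
-- C_5 □ C_5, where (x, y) ↦ x + 2y is checked by enumeration to separate
-- all pairs at distance 1 or 2 (`Reduction`).
module Submission where

open import Defs
open import Data.Nat using (ℕ; zero; suc; _+_; _*_; _≤_; _<_; s≤s; _%_; _/_; NonZero)
open import Data.Nat.Properties using (+-assoc; +-comm; <-irrefl; <⇒≱; suc-injective; ≤-trans; n≤1+n; m≤n⇒m<n∨m≡n)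
open import Data.Nat.DivMod using (m≡m%n+[m/n]*n; m%n<n; _mod_; %-congˡ; n%n≡0; m<n⇒m%n≡m; [m+kn]%n≡m%n; [m+n]%n≡m%n)
open import Data.Nat.Divisibility using (_∣_; divides; m%n≡0⇒n∣m)
open import Data.Fin using (Fin; toℕ)
open import Data.Fin.Patterns using (0F; 1F; 2F; 3F; 4F)
open import Data.Fin.Properties using (injective⇒≤; toℕ-fromℕ<; toℕ-injective; toℕ<n; all?) renaming (_≟_ to _≟ᶠ_)
open import Data.Vec using (Vec; []; _∷_)
open import Data.Vec.Relation.Unary.All using (All; []; _∷_)
open import Data.Vec.Relation.Unary.AllPairs using ([]; _∷_)
open import Data.Vec.Relation.Unary.Any using (here; there; any?)
open import Data.Vec.Relation.Unary.Unique.Propositional using (Unique)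
open import Data.Vec.Relation.Unary.Unique.Propositional.Properties using (lookup-injective)
open import Data.Vec.Membership.Propositional using (_∈_)
open import Relation.Nullary using (¬_; Dec; yes; no; contradiction; ¬?)
open import Relation.Nullary.Decidable using (True; toWitness; map′)
open import Relation.Binary.PropositionalEquality using (_≡_; _≢_; refl; sym; trans; cong; subst; subst₂; module ≡-Reasoning)
open import Data.Empty using (⊥-elim)
open import Data.Product using (Σ; _×_; _,_; proj₁; proj₂)
open import Data.Sum using (_⊎_; inj₁; inj₂)
open import Function using (_∘_)
open import Function.Bundles using (_⇔_; mk⇔)

missing⇒distinct : ∀ {A : Set} {n} {y : A} {xs : Vec A n} → ¬ (y ∈ xs) → All (y ≢_) xs
missing⇒distinct {xs = []}     _  = []
missing⇒distinct {xs = x ∷ xs} y∉ = (y∉ ∘ here) ∷ missing⇒distinct (y∉ ∘ there)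

unique⇒≤ : ∀ {k n} {xs : Vec (Fin k) n} → Unique xs → n ≤ k
unique⇒≤ u = injective⇒≤ (lookup-injective u _ _)

occurs : ∀ {k} {xs : Vec (Fin k) k} → Unique xs → (y : Fin k) → y ∈ xs
occurs {xs = xs} u y with any? (y ≟ᶠ_) xs
... | yes y∈xs = y∈xs
... | no  y∉xs = contradiction (unique⇒≤ (missing⇒distinct y∉xs ∷ u)) (<-irrefl refl)

record GridColouring (k : ℕ) : Set where
  field
    colour   : ℕ → ℕ → Fin k
    east₁    : ∀ a b → colour a b ≢ colour (1 + a) b
    north₁   : ∀ a b → colour a b ≢ colour a (1 + b)
    east₂    : ∀ a b → colour a b ≢ colour (2 + a) b
    north₂   : ∀ a b → colour a b ≢ colour a (2 + b)
    diagonal : ∀ a b → colour a b ≢ colour (1 + a) (1 + b)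
    anti     : ∀ a b → colour (1 + a) b ≢ colour a (1 + b)

  ball : ℕ → ℕ → Vec (Fin k) 5
  ball a b = colour (1 + a) (1 + b) ∷ colour a (1 + b) ∷ colour (2 + a) (1 + b)
           ∷ colour (1 + a) b ∷ colour (1 + a) (2 + b) ∷ []

  -- Any two cells of a closed neighbourhood are at distance ≤ 2.
  ball-unique : ∀ a b → Unique (ball a b)
  ball-unique a b =
      (≢sym (east₁ a (1 + b)) ∷ east₁ (1 + a) (1 + b) ∷ ≢sym (north₁ (1 + a) b) ∷ north₁ (1 + a) (1 + b) ∷ [])
    ∷ (east₂ a (1 + b) ∷ ≢sym (anti a b) ∷ diagonal a (1 + b) ∷ [])
    ∷ (≢sym (diagonal (1 + a) b) ∷ anti (1 + a) (1 + b) ∷ [])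
    ∷ (north₂ (1 + a) b ∷ [])
    ∷ [] ∷ []
    where
      ≢sym : ∀ {x y : Fin k} → x ≢ y → y ≢ x
      ≢sym x≢y = x≢y ∘ sym

  atLeastFive : 5 ≤ k
  atLeastFive = unique⇒≤ (ball-unique 0 0)

transpose : ∀ {k} → GridColouring k → GridColouring k
transpose G = record
  { colour   = λ a b → colour b a
  ; east₁    = λ a b → north₁ b a
  ; north₁   = λ a b → east₁ b a
  ; east₂    = λ a b → north₂ b a
  ; north₂   = λ a b → east₂ b a
  ; diagonal = λ a b → diagonal b a
  ; anti     = λ a b → anti b a ∘ sym
  }
  where open GridColouring G

pattern centre e = here e
pattern west   e = there (here e)
pattern east   e = there (there (here e))
pattern south  e = there (there (there (here e)))
pattern north  e = there (there (there (there (here e))))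

-- With five colours every ball shows every colour exactly once (`occurs`),
-- so a colour can be located by excluding four positions of a ball.  We
-- assume vertical periodicity, which lets us pass to rows b ≥ 2 where the
-- argument has room below and above.
module FiveColouring (G : GridColouring 5) {p : ℕ}
  (vertical : ∀ a b → GridColouring.colour G a (2 + p + b) ≡ GridColouring.colour G a b) where
  open GridColouring G

  -- Cells three apart in a row differ: their common colour would have to
  -- sit at both (1 + a, 2 + y) and (2 + a, 2 + y), which are adjacent.
  gap₃ : ∀ a y → colour a y ≢ colour (3 + a) y
  gap₃ a y same = east₁ (1 + a) (2 + y) (trans (sym viaLeft) viaRight)
    where
      viaLeft : colour a y ≡ colour (1 + a) (2 + y)
      viaLeft with occurs (ball-unique a y) (colour a y)
      ... | centre e = ⊥-elim (diagonal a y e)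
      ... | west   e = ⊥-elim (north₁ a y e)
      ... | east   e = ⊥-elim (anti (2 + a) y (trans (sym same) e))
      ... | south  e = ⊥-elim (east₁ a y e)
      ... | north  e = e

      viaRight : colour a y ≡ colour (2 + a) (2 + y)
      viaRight with occurs (ball-unique (1 + a) y) (colour a y)
      ... | centre e = ⊥-elim (anti (2 + a) y (trans (sym same) e))
      ... | west   e = ⊥-elim (diagonal a y e)
      ... | east   e = ⊥-elim (north₁ (3 + a) y (trans (sym same) e))
      ... | south  e = ⊥-elim (east₁ (2 + a) y (trans (sym e) same))
      ... | north  e = e

  -- Cells four apart in a row differ (in rows ≥ 2).  Their common colour
  -- lies directly below or above the midpoint; in the first case it is
  -- forced into row 4 + b at columns 1 + a and 3 + a, in the second into
  -- row b at the same columns — two cells at distance 2 either way.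
  gap₄ : ∀ a b → colour a (2 + b) ≢ colour (4 + a) (2 + b)
  gap₄ a b same with occurs (ball-unique (1 + a) (1 + b)) (colour a (2 + b))
  ... | centre e = east₂ a (2 + b) e
  ... | west   e = east₁ a (2 + b) e
  ... | east   e = east₁ (3 + a) (2 + b) (trans (sym e) same)
  ... | south  below = east₂ (1 + a) (4 + b) (trans (sym upLeft) upRight)
    where
      upLeft : colour a (2 + b) ≡ colour (1 + a) (4 + b)
      upLeft with occurs (ball-unique a (2 + b)) (colour a (2 + b))
      ... | centre e = ⊥-elim (diagonal a (2 + b) e)
      ... | west   e = ⊥-elim (north₁ a (2 + b) e)
      ... | east   e = ⊥-elim (north₂ (2 + a) (1 + b) (trans (sym below) e))
      ... | south  e = ⊥-elim (east₁ a (2 + b) e)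
      ... | north  e = e

      upRight : colour a (2 + b) ≡ colour (3 + a) (4 + b)
      upRight with occurs (ball-unique (2 + a) (2 + b)) (colour a (2 + b))
      ... | centre e = ⊥-elim (anti (3 + a) (2 + b) (trans (sym same) e))
      ... | west   e = ⊥-elim (north₂ (2 + a) (1 + b) (trans (sym below) e))
      ... | east   e = ⊥-elim (north₁ (4 + a) (2 + b) (trans (sym same) e))
      ... | south  e = ⊥-elim (east₁ (3 + a) (2 + b) (trans (sym e) same))
      ... | north  e = e
  ... | north  above = east₂ (1 + a) b (trans (sym downLeft) downRight)
    where
      downLeft : colour a (2 + b) ≡ colour (1 + a) b
      downLeft with occurs (ball-unique a b) (colour a (2 + b))
      ... | centre e = ⊥-elim (anti a (1 + b) (sym e))
      ... | west   e = ⊥-elim (north₁ a (1 + b) (sym e))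
      ... | east   e = ⊥-elim (north₂ (2 + a) (1 + b) (trans (sym e) above))
      ... | south  e = e
      ... | north  e = ⊥-elim (east₁ a (2 + b) e)

      downRight : colour a (2 + b) ≡ colour (3 + a) b
      downRight with occurs (ball-unique (2 + a) b) (colour a (2 + b))
      ... | centre e = ⊥-elim (diagonal (3 + a) (1 + b) (trans (sym e) same))
      ... | west   e = ⊥-elim (north₂ (2 + a) (1 + b) (trans (sym e) above))
      ... | east   e = ⊥-elim (north₁ (4 + a) (1 + b) (trans (sym e) same))
      ... | south  e = e
      ... | north  e = ⊥-elim (east₁ (3 + a) (2 + b) (trans (sym e) same))

  -- Five consecutive cells of a row ≥ 2 carry five distinct colours, and
  -- the sixth cell can only repeat the first.
  rowPeriod : ∀ a b → colour (5 + a) (2 + b) ≡ colour a (2 + b)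
  rowPeriod a b with occurs window (colour (5 + a) (2 + b))
    where
      y = 2 + b
      window : Unique (colour a y ∷ colour (1 + a) y ∷ colour (2 + a) y ∷ colour (3 + a) y ∷ colour (4 + a) y ∷ [])
      window = (east₁ a y ∷ east₂ a y ∷ gap₃ a y ∷ gap₄ a b ∷ [])
             ∷ (east₁ (1 + a) y ∷ east₂ (1 + a) y ∷ gap₃ (1 + a) y ∷ [])
             ∷ (east₁ (2 + a) y ∷ east₂ (2 + a) y ∷ [])
             ∷ (east₁ (3 + a) y ∷ [])
             ∷ [] ∷ []
  ... | here e = e
  ... | there (here e) = ⊥-elim (gap₄ (1 + a) b (sym e))
  ... | there (there (here e)) = ⊥-elim (gap₃ (2 + a) (2 + b) (sym e))
  ... | there (there (there (here e))) = ⊥-elim (east₂ (3 + a) (2 + b) (sym e))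
  ... | there (there (there (there (here e)))) = ⊥-elim (east₁ (4 + a) (2 + b) (sym e))

  fivePeriodic : ∀ a b → colour (5 + a) b ≡ colour a b
  fivePeriodic a b = begin
    colour (5 + a) b             ≡⟨ vertical (5 + a) b ⟨
    colour (5 + a) (2 + p + b)   ≡⟨ rowPeriod a (p + b) ⟩
    colour a (2 + p + b)         ≡⟨ vertical a b ⟩
    colour a b                   ∎
    where open ≡-Reasoning

  Period : ℕ → Set
  Period q = ∀ a b → colour (q + a) b ≡ colour a b

  multiplesOf5 : ∀ q → Period (q * 5)
  multiplesOf5 zero    a b = refl
  multiplesOf5 (suc q) a b = trans (fivePeriodic (q * 5 + a) b) (multiplesOf5 q a b)

  difference : ∀ q r → Period q → Period (q + r) → Period r
  difference q r P Q a b = begin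
    colour (r + a) b         ≡⟨ P (r + a) b ⟨
    colour (q + (r + a)) b   ≡⟨ cong (λ x → colour x b) (+-assoc q r a) ⟨
    colour (q + r + a) b     ≡⟨ Q a b ⟩
    colour a b               ∎
    where open ≡-Reasoning

  -- A period below 5 is 0: shifts by 1 and 2 are excluded by adjacency,
  -- shifts by 3 and 4 by combining them with the period 5.
  smallPeriod : ∀ r → r < 5 → Period r → r ≡ 0
  smallPeriod 0 _ _ = refl
  smallPeriod 1 _ P = ⊥-elim (east₁ 0 0 (sym (P 0 0)))
  smallPeriod 2 _ P = ⊥-elim (east₂ 0 0 (sym (P 0 0)))
  smallPeriod 3 _ P = ⊥-elim (east₂ 0 0 (trans (sym (fivePeriodic 0 0)) (P 2 0)))
  smallPeriod 4 _ P = ⊥-elim (east₁ 0 0 (trans (sym (fivePeriodic 0 0)) (P 1 0)))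
  smallPeriod (suc (suc (suc (suc (suc _))))) (s≤s (s≤s (s≤s (s≤s (s≤s ()))))) _

  period⇒5∣ : ∀ m → Period m → 5 ∣ m
  period⇒5∣ m P = m%n≡0⇒n∣m m 5 (smallPeriod (m % 5) (m%n<n m 5) remainder)
    where
      split : m ≡ m / 5 * 5 + m % 5
      split = trans (m≡m%n+[m/n]*n m 5) (+-comm (m % 5) (m / 5 * 5))

      remainder : Period (m % 5)
      remainder = difference (m / 5 * 5) (m % 5) (multiplesOf5 (m / 5))
                    (λ a b → trans (cong (λ x → colour (x + a) b) (sym split)) (P a b))

Next : ℕ → ℕ → ℕ → Set
Next m x y = (suc x ≡ y) ⊎ (suc x ≡ m × y ≡ 0)

next⇒adj : ∀ {m} {i j : Fin m} → Next m (toℕ i) (toℕ j) → CycAdj m i j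
next⇒adj (inj₁ e) = inj₁ e
next⇒adj (inj₂ w) = inj₂ (inj₂ (inj₁ w))

next⇒adj⁻ : ∀ {m} {i j : Fin m} → Next m (toℕ j) (toℕ i) → CycAdj m i j
next⇒adj⁻ (inj₁ e) = inj₂ (inj₁ e)
next⇒adj⁻ (inj₂ w) = inj₂ (inj₂ (inj₂ w))

adj⇒next : ∀ {m} {i j : Fin m} → CycAdj m i j → Next m (toℕ i) (toℕ j) ⊎ Next m (toℕ j) (toℕ i)
adj⇒next (inj₁ e)               = inj₁ (inj₁ e)
adj⇒next (inj₂ (inj₁ e))        = inj₂ (inj₁ e)
adj⇒next (inj₂ (inj₂ (inj₁ w))) = inj₁ (inj₂ w)
adj⇒next (inj₂ (inj₂ (inj₂ w))) = inj₂ (inj₂ w)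

next-injˡ : ∀ {m x x' y} → Next m x y → Next m x' y → x ≡ x'
next-injˡ (inj₁ refl)     (inj₁ e)        = sym (suc-injective e)
next-injˡ (inj₁ refl)     (inj₂ (_ , ()))
next-injˡ (inj₂ (_ , refl)) (inj₁ ())
next-injˡ (inj₂ (e , _))  (inj₂ (e' , _)) = suc-injective (trans e (sym e'))

next-injʳ : ∀ {m x y y'} → y < m → y' < m → Next m x y → Next m x y' → y ≡ y'
next-injʳ _   _    (inj₁ e)           (inj₁ e')           = trans (sym e) e'
next-injʳ y<m _    (inj₁ refl)        (inj₂ (refl , _))   = contradiction y<m (<-irrefl refl)
next-injʳ _   y'<m (inj₂ (refl , _))  (inj₁ refl)         = contradiction y'<m (<-irrefl refl)
next-injʳ _   _    (inj₂ (_ , refl))  (inj₂ (_ , refl))   = refl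

next-irrefl : ∀ {m x} → 2 ≤ m → ¬ Next m x x
next-irrefl _   (inj₁ ())
next-irrefl 2≤1 (inj₂ (refl , refl)) = contradiction 2≤1 λ { (s≤s ()) }

next-asym : ∀ {m x y} → 3 ≤ m → Next m x y → ¬ Next m y x
next-asym _   (inj₁ refl)         (inj₁ ())
next-asym 3≤2 (inj₁ refl)         (inj₂ (refl , refl)) = contradiction 3≤2 λ { (s≤s (s≤s ())) }
next-asym 3≤2 (inj₂ (refl , refl)) (inj₁ refl)         = contradiction 3≤2 λ { (s≤s (s≤s ())) }
next-asym 3≤1 (inj₂ (refl , refl)) (inj₂ (refl , _))   = contradiction 3≤1 λ { (s≤s ()) }

suc-% : ∀ m .{{_ : NonZero m}} a → suc a % m ≡ suc (a % m) % m
suc-% m a = trans (%-congˡ (cong suc (m≡m%n+[m/n]*n a m))) ([m+kn]%n≡m%n (suc (a % m)) (a / m) m)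

next-% : ∀ m .{{_ : NonZero m}} a → Next m (a % m) (suc a % m)
next-% m a with m≤n⇒m<n∨m≡n (m%n<n a m)
... | inj₁ r+1<m = inj₁ (sym (trans (suc-% m a) (m<n⇒m%n≡m r+1<m)))
... | inj₂ r+1≡m = inj₂ (r+1≡m , trans (suc-% m a) (trans (%-congˡ r+1≡m) (n%n≡0 m)))

module Covering (m : ℕ) .{{_ : NonZero m}} where

  next-mod : ∀ a → Next m (toℕ (a mod m)) (toℕ (suc a mod m))
  next-mod a = subst₂ (Next m) (sym (toℕ-fromℕ< _)) (sym (toℕ-fromℕ< _)) (next-% m a)

  forward : ∀ a → CycAdj m (a mod m) (suc a mod m)
  forward a = next⇒adj (next-mod a)

  backward : ∀ a → CycAdj m (suc a mod m) (a mod m)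
  backward a = next⇒adj⁻ (next-mod a)

  distinct₁ : 2 ≤ m → ∀ a → a mod m ≢ suc a mod m
  distinct₁ 2≤m a e = next-irrefl 2≤m (subst (λ i → Next m (toℕ (a mod m)) (toℕ i)) (sym e) (next-mod a))

  distinct₂ : 3 ≤ m → ∀ a → a mod m ≢ suc (suc a) mod m
  distinct₂ 3≤m a e =
    next-asym 3≤m (next-mod a) (subst (λ i → Next m (toℕ (suc a mod m)) (toℕ i)) (sym e) (next-mod (suc a)))

  periodic : ∀ a → (m + a) mod m ≡ a mod m
  periodic a = toℕ-injective (begin
    toℕ ((m + a) mod m)   ≡⟨ toℕ-fromℕ< _ ⟩
    (m + a) % m           ≡⟨ %-congˡ (+-comm m a) ⟩
    (a + m) % m           ≡⟨ [m+n]%n≡m%n a m ⟩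
    a % m                 ≡⟨ toℕ-fromℕ< _ ⟨
    toℕ (a mod m)         ∎)
    where open ≡-Reasoning

module Unfolding {m n k : ℕ} .{{_ : NonZero m}} .{{_ : NonZero n}} (3≤m : 3 ≤ m) (3≤n : 3 ≤ n)
  (c : V (Torus m n) → Fin k) (proper : ∀ u v → Adj (Square (Torus m n)) u v → c u ≢ c v) where

  module X = Covering m
  module Y = Covering n

  2≤m : 2 ≤ m
  2≤m = ≤-trans (n≤1+n 2) 3≤m

  2≤n : 2 ≤ n
  2≤n = ≤-trans (n≤1+n 2) 3≤n

  cell : ℕ → ℕ → V (Torus m n)
  cell a b = a mod m , b mod n

  horizontal : ∀ {i i' j} → CycAdj m i i' → Adj (Torus m n) (i , j) (i' , j)
  horizontal adj = inj₁ (adj , refl)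

  vertical : ∀ {i j j'} → CycAdj n j j' → Adj (Torus m n) (i , j) (i , j')
  vertical adj = inj₂ (refl , adj)

  near₁ : ∀ {u v} → u ≢ v → Adj (Torus m n) u v → c u ≢ c v
  near₁ u≢v uv = proper _ _ (u≢v , inj₁ uv)

  near₂ : ∀ {u w v} → u ≢ v → Adj (Torus m n) u w → Adj (Torus m n) w v → c u ≢ c v
  near₂ u≢v uw wv = proper _ _ (u≢v , inj₂ (_ , uw , wv))

  grid : GridColouring k
  grid = record
    { colour   = λ a b → c (cell a b)
    ; east₁    = λ a b → near₁ (X.distinct₁ 2≤m a ∘ cong proj₁) (horizontal (X.forward a))
    ; north₁   = λ a b → near₁ (Y.distinct₁ 2≤n b ∘ cong proj₂) (vertical (Y.forward b))
    ; east₂    = λ a b → near₂ (X.distinct₂ 3≤m a ∘ cong proj₁)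
                            (horizontal (X.forward a)) (horizontal (X.forward (suc a)))
    ; north₂   = λ a b → near₂ (Y.distinct₂ 3≤n b ∘ cong proj₂)
                            (vertical (Y.forward b)) (vertical (Y.forward (suc b)))
    ; diagonal = λ a b → near₂ (X.distinct₁ 2≤m a ∘ cong proj₁)
                            (horizontal (X.forward a)) (vertical (Y.forward b))
    ; anti     = λ a b → near₂ (X.distinct₁ 2≤m a ∘ sym ∘ cong proj₁)
                            (horizontal (X.backward a)) (vertical (Y.forward b))
    }

  open GridColouring grid using (colour)

  periodicₓ : ∀ a b → colour (m + a) b ≡ colour a b
  periodicₓ a b = cong (λ i → c (i , b mod n)) (X.periodic a)

  periodicᵧ : ∀ a b → colour a (n + b) ≡ colour a b
  periodicᵧ a b = cong (λ j → c (a mod m , j)) (Y.periodic b)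

rot : Fin 5 → Fin 5
rot 0F = 1F
rot 1F = 2F
rot 2F = 3F
rot 3F = 4F
rot 4F = 0F

rot⁻¹ : Fin 5 → Fin 5
rot⁻¹ 0F = 4F
rot⁻¹ 1F = 0F
rot⁻¹ 2F = 1F
rot⁻¹ 3F = 2F
rot⁻¹ 4F = 3F

rot⁻¹-rot : ∀ x → rot⁻¹ (rot x) ≡ x
rot⁻¹-rot 0F = refl
rot⁻¹-rot 1F = refl
rot⁻¹-rot 2F = refl
rot⁻¹-rot 3F = refl
rot⁻¹-rot 4F = refl

rot⁵ : ∀ x → rot (rot (rot (rot (rot x)))) ≡ x
rot⁵ 0F = refl
rot⁵ 1F = refl
rot⁵ 2F = refl
rot⁵ 3F = refl
rot⁵ 4F = refl

residue : ℕ → Fin 5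
residue zero    = 0F
residue (suc a) = rot (residue a)

residue-multiple : ∀ {a} → 5 ∣ a → residue a ≡ 0F
residue-multiple (divides q refl) = go q
  where
    go : ∀ q → residue (q * 5) ≡ 0F
    go zero    = refl
    go (suc q) = trans (rot⁵ (residue (q * 5))) (go q)

residue-next : ∀ {m x y} → 5 ∣ m → Next m x y → residue y ≡ rot (residue x)
residue-next _   (inj₁ refl)         = refl
residue-next 5∣m (inj₂ (refl , refl)) = sym (residue-multiple 5∣m)

data Dir : Set where
  right left up down : Dir

opposite : Dir → Dir
opposite right  = left
opposite left  = right
opposite up = down
opposite down = up

Z5² : Set
Z5² = Fin 5 × Fin 5

shift : Dir → Z5² → Z5²
shift right  (x , y) = rot x , y
shift left  (x , y) = rot⁻¹ x , y
shift up (x , y) = x , rot y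
shift down (x , y) = x , rot⁻¹ y

hue : Z5² → Fin 5
hue (x , y) = residue (toℕ x + toℕ y + toℕ y)

Recolours : (Z5² → Z5²) → Set
Recolours f = ∀ p → hue (f p) ≢ hue p

recolours? : ∀ f → Dec (Recolours f)
recolours? f = map′ (λ h p → h (proj₁ p) (proj₂ p)) (λ h x y → h (x , y))
                    (all? λ x → all? λ y → ¬? (hue (f (x , y)) ≟ᶠ hue (x , y)))

byEnumeration : ∀ f {_ : True (recolours? f)} → Recolours f
byEnumeration f {ok} = toWitness ok

oneStep : ∀ d → Recolours (shift d)
oneStep right  = byEnumeration (shift right)
oneStep left  = byEnumeration (shift left)
oneStep up = byEnumeration (shift up)
oneStep down = byEnumeration (shift down)

twoSteps : ∀ d d' p → hue (shift d' (shift d p)) ≡ hue p → d' ≡ opposite d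
twoSteps right  left  _ _ = refl
twoSteps left  right  _ _ = refl
twoSteps up down _ _ = refl
twoSteps down up _ _ = refl
twoSteps right  right  p e = ⊥-elim (byEnumeration (shift right  ∘ shift right)  p e)
twoSteps right  up p e = ⊥-elim (byEnumeration (shift up ∘ shift right)  p e)
twoSteps right  down p e = ⊥-elim (byEnumeration (shift down ∘ shift right)  p e)
twoSteps left  left  p e = ⊥-elim (byEnumeration (shift left  ∘ shift left)  p e)
twoSteps left  up p e = ⊥-elim (byEnumeration (shift up ∘ shift left)  p e)
twoSteps left  down p e = ⊥-elim (byEnumeration (shift down ∘ shift left)  p e)
twoSteps up right  p e = ⊥-elim (byEnumeration (shift right  ∘ shift up) p e)
twoSteps up left  p e = ⊥-elim (byEnumeration (shift left  ∘ shift up) p e)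
twoSteps up up p e = ⊥-elim (byEnumeration (shift up ∘ shift up) p e)
twoSteps down right  p e = ⊥-elim (byEnumeration (shift right  ∘ shift down) p e)
twoSteps down left  p e = ⊥-elim (byEnumeration (shift left  ∘ shift down) p e)
twoSteps down down p e = ⊥-elim (byEnumeration (shift down ∘ shift down) p e)

-- When 5 ∣ m and 5 ∣ n, the hue of the residues is a proper 5-colouring
-- of the square of C_m □ C_n: each edge of the torus is a step in some
-- direction, reduction mod 5 turns it into the matching translation of Z5²,
-- and a two-step path that returns its first step ends where it started.
module Reduction {m n : ℕ} (5∣m : 5 ∣ m) (5∣n : 5 ∣ n) where

  Move : Dir → V (Torus m n) → V (Torus m n) → Set
  Move right  (i , j) (i' , j') = Next m (toℕ i) (toℕ i') × j ≡ j'
  Move left  (i , j) (i' , j') = Next m (toℕ i') (toℕ i) × j ≡ j'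
  Move up (i , j) (i' , j') = i ≡ i' × Next n (toℕ j) (toℕ j')
  Move down (i , j) (i' , j') = i ≡ i' × Next n (toℕ j') (toℕ j)

  edge⇒move : ∀ u v → Adj (Torus m n) u v → Σ Dir λ d → Move d u v
  edge⇒move u v (inj₁ (adj , refl)) with adj⇒next adj
  ... | inj₁ nx = right , nx , refl
  ... | inj₂ nx = left , nx , refl
  edge⇒move u v (inj₂ (refl , adj)) with adj⇒next adj
  ... | inj₁ ny = up , refl , ny
  ... | inj₂ ny = down , refl , ny

  reduce : V (Torus m n) → Z5²
  reduce u = residue (toℕ (proj₁ u)) , residue (toℕ (proj₂ u))

  backwards : ∀ {k x y} → 5 ∣ k → Next k x y → residue x ≡ rot⁻¹ (residue y)
  backwards 5∣k nx = trans (sym (rot⁻¹-rot _)) (cong rot⁻¹ (sym (residue-next 5∣k nx)))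

  move-reduce : ∀ d u v → Move d u v → reduce v ≡ shift d (reduce u)
  move-reduce right  u v (nx , refl) = cong (_, _) (residue-next 5∣m nx)
  move-reduce left  u v (nx , refl) = cong (_, _) (backwards 5∣m nx)
  move-reduce up u v (refl , ny) = cong (_ ,_) (residue-next 5∣n ny)
  move-reduce down u v (refl , ny) = cong (_ ,_) (backwards 5∣n ny)

  move-back : ∀ d u w v → Move d u w → Move (opposite d) w v → u ≡ v
  move-back right  u w v (p , refl) (q , refl) = cong (_, _) (toℕ-injective (next-injˡ p q))
  move-back left  u w v (p , refl) (q , refl) = cong (_, _) (toℕ-injective (next-injʳ (toℕ<n _) (toℕ<n _) p q))
  move-back up u w v (refl , p) (refl , q) = cong (_ ,_) (toℕ-injective (next-injˡ p q))
  move-back down u w v (refl , p) (refl , q) = cong (_ ,_) (toℕ-injective (next-injʳ (toℕ<n _) (toℕ<n _) p q))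

  colouring : Colorable (Square (Torus m n)) 5
  colouring = hue ∘ reduce , proper
    where
      proper : ∀ u v → Adj (Square (Torus m n)) u v → hue (reduce u) ≢ hue (reduce v)
      proper u v (_ , inj₁ uv) same with edge⇒move u v uv
      ... | d , mv = oneStep d (reduce u) (trans (cong hue (sym (move-reduce d u v mv))) (sym same))
      proper u v (u≢v , inj₂ (w , uw , wv)) same with edge⇒move u w uw | edge⇒move w v wv
      ... | d , mv | d' , mv' = u≢v (move-back d u w v mv (subst (λ e → Move e w v) returns mv'))
        where
          returns : d' ≡ opposite d
          returns = twoSteps d d' (reduce u) (begin
            hue (shift d' (shift d (reduce u)))  ≡⟨ cong (hue ∘ shift d') (move-reduce d u w mv) ⟨
            hue (shift d' (reduce w))            ≡⟨ cong hue (move-reduce d' w v mv') ⟨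
            hue (reduce v)                       ≡⟨ same ⟨
            hue (reduce u)                       ∎)
            where open ≡-Reasoning

atLeastFiveColours : ∀ {m n k} → 3 ≤ m → 3 ≤ n → Colorable (Square (Torus m n)) k → 5 ≤ k
atLeastFiveColours 3≤m@(s≤s (s≤s (s≤s _))) 3≤n@(s≤s (s≤s (s≤s _))) (c , proper) =
  GridColouring.atLeastFive (Unfolding.grid 3≤m 3≤n c proper)

-- A proper 5-colouring exists only when 5 ∣ m and 5 ∣ n: apply the period
-- argument to the unfolded colouring and to its transpose.
fiveColours⇒5∣ : ∀ {m n} → 3 ≤ m → 3 ≤ n → Colorable (Square (Torus m n)) 5 → 5 ∣ m × 5 ∣ n
fiveColours⇒5∣ {m} {n} 3≤m@(s≤s (s≤s (s≤s {n = m'} _))) 3≤n@(s≤s (s≤s (s≤s {n = n'} _))) (c , proper) =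
    FiveColouring.period⇒5∣ grid {suc n'} periodicᵧ m periodicₓ
  , FiveColouring.period⇒5∣ (transpose grid) {suc m'} (λ a b → periodicₓ b a) n (λ a b → periodicᵧ b a)
  where open Unfolding 3≤m 3≤n c proper

corollary7 : (m n : ℕ) → 3 ≤ m → 3 ≤ n →
    ChromaticNumber≥ (Square (Torus m n)) 5
    × (ChromaticNumber≡ (Square (Torus m n)) 5 ⇔ (5 ∣ m × 5 ∣ n))
corollary7 m n 3≤m 3≤n = lowerBound , mk⇔ (fiveColours⇒5∣ 3≤m 3≤n ∘ proj₁) construction
  where
    lowerBound : ChromaticNumber≥ (Square (Torus m n)) 5
    lowerBound j j<5 colourable = <⇒≱ j<5 (atLeastFiveColours 3≤m 3≤n colourable)

    construction : 5 ∣ m × 5 ∣ n → ChromaticNumber≡ (Square (Torus m n)) 5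
    construction (5∣m , 5∣n) = Reduction.colouring 5∣m 5∣n , lowerBound
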